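{- Let $H$ be a group, $a\in H$, let $v$ be a non-negative integer, and let $\beta=\langle\beta_1\ldots\beta_\ell\rangle$ be a Fibonacci representation of $v$. Define elements of $H$ by $(d_{\ell+1},e_{\ell+1})=(1,1)$ and, for $i=\ell,\ell-1,\ldots,1$, $$d_i=e_{i+1}\,a^{\beta_i},\qquad e_i=d_{i+1}\,e_{i+1}\,a^{\beta_i}.$$ (Equivalently, $d_i=a^{u_i}$, $e_i=a^{v_i}$ with $u_{\ell+1}=v_{\ell+1}=0$, $u_i=v_{i+1}+\beta_i$, $v_i=u_{i+1}+v_{i+1}+\beta_i$.) Then $(d_1,e_1)=(a^{G(v)},a^{v})$.
   Context: $F_0=0$, $F_1=1$, $F_i=F_{i-1}+F_{i-2}$ are the Fibonacci numbers and $\phi=(1+\sqrt5)/2$. A bit string $\beta=\langle\beta_1\ldots\beta_\ell\rangle$ has $\beta_i\in\{0,1\}$; its Fibonacci sum is $\mathrm{FibSum}(\beta)=\sum_{i=1}^{\ell}\beta_iF_{i+1}$, and $\beta$ is a Fibonacci representation of $n$ if $\mathrm{FibSum}(\beta)=n$ (the empty string represents $0$). Hofstadter's G function is $G(x)=\lfloor\phi^{ -1}(x+1)\rfloor$ for integers $x\ge 0$ (this coincides with the recursion $G(0)=0$, $G(1)=1$, $G(x)=x-G(G(x-1))$). The group operation is written multiplicatively with identity $1$. -}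

module Defs where

open import Level using (Level)
open import Data.Bool using (Bool; true; false; if_then_else_)
open import Data.Nat using (ℕ; zero; suc; _+_; _*_; _≤?_)
open import Data.List using (List; []; _∷_; map; filter; length; upTo)
open import Data.Product using (_×_; _,_)
open import Algebra.Bundles using (Group)

F : ℕ → ℕ
F zero = 0
F (suc zero) = 1
F (suc (suc i)) = F (suc i) + F i

bit : Bool → ℕ
bit false = 0
bit true = 1

FibSumFrom : ℕ → List Bool → ℕ
FibSumFrom k [] = 0
FibSumFrom k (b ∷ bs) = bit b * F (suc k) + FibSumFrom (suc k) bs

FibSum : List Bool → ℕ
FibSum = FibSumFrom 1

-- Hofstadter's G (x) = ⌊ φ⁻¹ (x+1) ⌋ with φ⁻¹ = (√5 − 1)/2.
-- For integers g ≥ 0, x ≥ 0:  g ≤ φ⁻¹(x+1)  ⟺  2g + (x+1) ≤ √5 (x+1)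
--   ⟺ (2g + x + 1)² ≤ 5 (x+1)².
-- Since this condition is monotone (downward closed) in g and holds for g = 0,
-- the floor equals the number of g ∈ {1, …, x+1} satisfying it.
G : ℕ → ℕ
G x = length (filter (λ g → (2 * g + suc x) * (2 * g + suc x) ≤? 5 * (suc x * suc x))
                     (map suc (upTo (suc x))))

module _ {c ℓ : Level} (H : Group c ℓ) where
  open Group H

  pow : Carrier → ℕ → Carrier
  pow a zero = ε
  pow a (suc n) = a ∙ pow a n

  de : Carrier → List Bool → Carrier × Carrier
  de a [] = ε , ε
  de a (b ∷ bs) with de a bs
  ... | d' , e' = (e' ∙ pow a (bit b)) , ((d' ∙ e') ∙ pow a (bit b))

{-# OPTIONS --safe #-}
-- Unfolding the recursion, (d₁, e₁) = (a^u, a^v) where v = Σ βᵢ Fᵢ₊₁ and u = Σ βᵢ Fᵢ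
-- is the same sum with every Fibonacci index lowered by one. So it remains to
-- show G(v) = u, i.e. φ u < v + 1 < φ (u + 1). This bracket holds for the empty
-- string and survives prepending a bit b, which maps (u, v) to (v + b, v + u + b):
-- because φ² = φ + 1, the conditions φ p < q and q + p < φ q are equivalent, and so
-- are q < φ p and φ q < q + p.
module Submission where

open import Defs
open import Level using (Level)
open import Function using (_∘_)
open import Data.Bool using (Bool; true; false)
open import Data.Nat using (ℕ; zero; suc; _+_; _*_; _∸_; _≤_; _<_; _≤?_; _<?_; z<s; s<s)
open import Data.Nat.Properties
open import Data.Nat.Tactic.RingSolver using (solve; solve-∀)
open import Data.List using (List; []; _∷_; filter; length; applyUpTo)
open import Data.List.Properties using (filter-none; filter-accept; map-upTo)
open import Data.List.Relation.Unary.All.Properties using (applyUpTo⁺₁)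
open import Data.Product using (proj₁; proj₂; _×_; _,_)
open import Relation.Binary.PropositionalEquality as ≡ using (_≡_; refl; cong; subst; module ≡-Reasoning)
open import Relation.Nullary using (¬_)
open import Relation.Nullary.Decidable using (from-yes)
open import Relation.Unary using (Pred; Decidable)
open import Algebra.Bundles using (Group)

m+n≡o+p∧m<o⇒p<n : ∀ {m n o p} → m + n ≡ o + p → m < o → p < n
m+n≡o+p∧m<o⇒p<n eq m<o = ≰⇒> λ n≤p → <⇒≢ (+-mono-<-≤ m<o n≤p) eq

module _ {a p} {A : Set a} {P : Pred A p} (P? : Decidable P) where

  length-filter-applyUpTo : ∀ (f : ℕ → A) u k →
                            (∀ {i} → i < u → P (f i)) → (∀ {i} → i < k → ¬ P (f (u + i))) →
                            length (filter P? (applyUpTo f (u + k))) ≡ u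
  length-filter-applyUpTo f zero k _ no = cong length (filter-none P? (applyUpTo⁺₁ f k no))
  length-filter-applyUpTo f (suc u) k yes no =
    ≡.trans (cong length (filter-accept P? (yes z<s)))
            (cong suc (length-filter-applyUpTo (f ∘ suc) u k (yes ∘ s<s) no))

FibSumFrom-suc-suc : ∀ k β → FibSumFrom (suc (suc k)) β ≡ FibSumFrom (suc k) β + FibSumFrom k β
FibSumFrom-suc-suc k [] = refl
FibSumFrom-suc-suc k (b ∷ bs) rewrite FibSumFrom-suc-suc (suc k) bs =
  distrib (bit b) (F (suc (suc k))) (F (suc k)) (FibSumFrom (suc (suc k)) bs) (FibSumFrom (suc k) bs)
  where
  distrib : ∀ x p q s t → x * (p + q) + (s + t) ≡ (x * p + s) + (x * q + t)
  distrib = solve-∀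

module _ {c ℓ : Level} (H : Group c ℓ) (a : Group.Carrier H) where
  open Group H renaming (refl to ≈-refl)
  open import Algebra.Properties.Monoid.Mult monoid using (×-homo-+) renaming (_×_ to _×ᴹ_)

  pow≡×ᴹ : ∀ n → pow H a n ≡ n ×ᴹ a
  pow≡×ᴹ zero = refl
  pow≡×ᴹ (suc n) = cong (a ∙_) (pow≡×ᴹ n)

  pow-+ : ∀ m n → pow H a (m + n) ≈ pow H a m ∙ pow H a n
  pow-+ m n rewrite pow≡×ᴹ (m + n) | pow≡×ᴹ m | pow≡×ᴹ n = ×-homo-+ a m n

  pow-∙-bit : ∀ m b → pow H a m ∙ pow H a (bit b) ≈ pow H a (bit b * 1 + m)
  pow-∙-bit m b = trans (sym (pow-+ m (bit b))) (reflexive (cong (pow H a) m+b≡b*1+m))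
    where
    m+b≡b*1+m : m + bit b ≡ bit b * 1 + m
    m+b≡b*1+m = ≡.trans (+-comm m (bit b)) (cong (_+ m) (≡.sym (*-identityʳ (bit b))))

  de≈pow : ∀ β → proj₁ (de H a β) ≈ pow H a (FibSumFrom 0 β) × proj₂ (de H a β) ≈ pow H a (FibSumFrom 1 β)
  de≈pow [] = ≈-refl , ≈-refl
  de≈pow (b ∷ bs) with d≈aᵘ , e≈aⁿ ← de≈pow bs = trans (∙-congʳ e≈aⁿ) (pow-∙-bit n b) , (begin
    (proj₁ (de H a bs) ∙ proj₂ (de H a bs)) ∙ pow H a (bit b) ≈⟨ ∙-congʳ (∙-cong d≈aᵘ e≈aⁿ) ⟩
    (pow H a u ∙ pow H a n) ∙ pow H a (bit b)                 ≈⟨ ∙-congʳ (pow-+ u n) ⟨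
    pow H a (u + n) ∙ pow H a (bit b)                         ≈⟨ pow-∙-bit (u + n) b ⟩
    pow H a (bit b * 1 + (u + n))                             ≡⟨ cong (λ m → pow H a (bit b * 1 + m)) u+n≡FibSumFrom2 ⟩
    pow H a (bit b * 1 + FibSumFrom 2 bs)                     ∎)
    where
    open import Relation.Binary.Reasoning.Setoid setoid
    u = FibSumFrom 0 bs
    n = FibSumFrom 1 bs
    u+n≡FibSumFrom2 : u + n ≡ FibSumFrom 2 bs
    u+n≡FibSumFrom2 = ≡.trans (+-comm u n) (≡.sym (FibSumFrom-suc-suc 0 bs))

infix 4 φ·_<_ _<φ·_

-- φ· p < q and q <φ· p encode φ p < q and q < φ p: as 2φ = 1 + √5, the former holds
-- iff 2p + q < √5 q.
φ·_<_ : ℕ → ℕ → Set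
φ· p < q = (2 * p + q) * (2 * p + q) < 5 * (q * q)

_<φ·_ : ℕ → ℕ → Set
q <φ· p = 5 * (q * q) < (2 * p + q) * (2 * p + q)

2*+-squared-monoˡ-≤ : ∀ {g h} x → g ≤ h → (2 * g + x) * (2 * g + x) ≤ (2 * h + x) * (2 * h + x)
2*+-squared-monoˡ-≤ x g≤h = *-mono-≤ 2g+x≤2h+x 2g+x≤2h+x
  where 2g+x≤2h+x = +-monoˡ-≤ x (*-monoʳ-≤ 2 g≤h)

φ·-swap : ∀ p q → (2 * p + q) * (2 * p + q) + (2 * q + (q + p)) * (2 * q + (q + p))
                ≡ 5 * (q * q) + 5 * ((q + p) * (q + p))
φ·-swap p q = solve (p ∷ q ∷ [])

φ·<⇒+<φ· : ∀ p q → φ· p < q → q + p <φ· q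
φ·<⇒+<φ· p q = m+n≡o+p∧m<o⇒p<n (φ·-swap p q)

<φ·⇒φ·<+ : ∀ p q → q <φ· p → φ· q < q + p
<φ·⇒φ·<+ p q = m+n≡o+p∧m<o⇒p<n (≡.sym (φ·-swap p q))

φ·<⇒< : ∀ p q → φ· p < q → p < q
φ·<⇒< p q φp<q = ≰⇒> λ q≤p → <⇒≱ φp<q (begin
  5 * (q * q)                    ≤⟨ m≤m+n (5 * (q * q)) (4 * (q * q)) ⟩
  5 * (q * q) + 4 * (q * q)      ≡⟨ solve (q ∷ []) ⟩
  (2 * q + q) * (2 * q + q)      ≤⟨ 2*+-squared-monoˡ-≤ q q≤p ⟩
  (2 * p + q) * (2 * p + q)      ∎)
  where open ≤-Reasoning

φ·<-suc : ∀ p q → φ· p < q → φ· p < suc q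
φ·<-suc p q φp<q = begin-strict
  (2 * p + suc q) * (2 * p + suc q)                 ≡⟨ solve (p ∷ q ∷ []) ⟩
  (2 * p + q) * (2 * p + q) + (4 * p + (2 * q + 1)) <⟨ +-mono-<-≤ φp<q (+-monoˡ-≤ (2 * q + 1) (*-monoʳ-≤ 4 p≤q)) ⟩
  5 * (q * q) + (4 * q + (2 * q + 1))               ≤⟨ m≤m+n _ (4 * q + 4) ⟩
  5 * (q * q) + (4 * q + (2 * q + 1)) + (4 * q + 4) ≡⟨ solve (q ∷ []) ⟩
  5 * (suc q * suc q)                               ∎
  where
  open ≤-Reasoning
  p≤q : p ≤ q
  p≤q = <⇒≤ (φ·<⇒< p q φp<q)

<φ·-pred : ∀ p q → p ≤ suc q → suc q <φ· p → q <φ· p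
<φ·-pred p q p≤1+q 1+q<φp =
  +-cancelʳ-< (6 * q + 5) (5 * (q * q)) ((2 * p + q) * (2 * p + q)) (begin-strict
  5 * (q * q) + (6 * q + 5)                         ≤⟨ +-monoʳ-≤ (5 * (q * q)) (m≤n+m (6 * q + 5) (4 * q)) ⟩
  5 * (q * q) + (4 * q + (6 * q + 5))               ≡⟨ solve (q ∷ []) ⟩
  5 * (suc q * suc q)                               <⟨ 1+q<φp ⟩
  (2 * p + suc q) * (2 * p + suc q)                 ≡⟨ solve (p ∷ q ∷ []) ⟩
  (2 * p + q) * (2 * p + q) + (4 * p + (2 * q + 1)) ≤⟨ +-monoʳ-≤ ((2 * p + q) * (2 * p + q)) (+-monoˡ-≤ (2 * q + 1) (*-monoʳ-≤ 4 p≤1+q)) ⟩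
  (2 * p + q) * (2 * p + q) + (4 * suc q + (2 * q + 1)) ≡⟨ solve (p ∷ q ∷ []) ⟩
  (2 * p + q) * (2 * p + q) + (6 * q + 5)           ∎)
  where open ≤-Reasoning

infix 4 _≡⌊_/φ⌋

-- φ u < x < φ (u + 1); for x ≥ 1 this says u = ⌊x/φ⌋, as φ is irrational.
record _≡⌊_/φ⌋ (u x : ℕ) : Set where
  constructor _,_
  field
    lower : φ· u < x
    upper : x <φ· suc u

⌊/φ⌋-step : ∀ b {u n} → u ≡⌊ suc n /φ⌋ → bit b * 1 + n ≡⌊ suc (bit b * 1 + (n + u)) /φ⌋
⌊/φ⌋-step false {u} {n} (φu<1+n , 1+n<φ[1+u]) =
  subst (φ· n <_) (+-suc n u) (<φ·⇒φ·<+ (suc u) n (<φ·-pred (suc u) n (φ·<⇒< u (suc n) φu<1+n) 1+n<φ[1+u]))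
  , φ·<⇒+<φ· u (suc n) φu<1+n
⌊/φ⌋-step true {u} {n} (φu<1+n , 1+n<φ[1+u]) =
  subst (φ· suc n <_) (cong suc (+-suc n u)) (<φ·⇒φ·<+ (suc u) (suc n) 1+n<φ[1+u])
  , φ·<⇒+<φ· u (suc (suc n)) (φ·<-suc u (suc n) φu<1+n)

FibSumFrom0≡⌊1+FibSum/φ⌋ : ∀ β → FibSumFrom 0 β ≡⌊ suc (FibSum β) /φ⌋
FibSumFrom0≡⌊1+FibSum/φ⌋ [] = from-yes (1 <? 5) , from-yes (5 <? 9)
FibSumFrom0≡⌊1+FibSum/φ⌋ (b ∷ bs) rewrite FibSumFrom-suc-suc 0 bs = ⌊/φ⌋-step b (FibSumFrom0≡⌊1+FibSum/φ⌋ bs)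

≡⌊/φ⌋⇒G≡ : ∀ {u n} → u ≡⌊ suc n /φ⌋ → G n ≡ u
≡⌊/φ⌋⇒G≡ {u} {n} (φu<1+n , 1+n<φ[1+u]) = begin
  G n                                                  ≡⟨ cong (length ∘ filter P?) (map-upTo suc (suc n)) ⟩
  length (filter P? (applyUpTo suc (suc n)))           ≡⟨ cong (length ∘ filter P? ∘ applyUpTo suc) (≡.sym (m+[n∸m]≡n u≤1+n)) ⟩
  length (filter P? (applyUpTo suc (u + (suc n ∸ u)))) ≡⟨ length-filter-applyUpTo P? suc u (suc n ∸ u) below above ⟩
  u                                                    ∎
  where
  open ≡-Reasoning
  P? : Decidable (λ g → (2 * g + suc n) * (2 * g + suc n) ≤ 5 * (suc n * suc n))
  P? g = (2 * g + suc n) * (2 * g + suc n) ≤? 5 * (suc n * suc n)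
  u≤1+n : u ≤ suc n
  u≤1+n = <⇒≤ (φ·<⇒< u (suc n) φu<1+n)
  below : ∀ {i} → i < u → (2 * suc i + suc n) * (2 * suc i + suc n) ≤ 5 * (suc n * suc n)
  below i<u = ≤-trans (2*+-squared-monoˡ-≤ (suc n) i<u) (<⇒≤ φu<1+n)
  above : ∀ {i} → i < suc n ∸ u → ¬ (2 * suc (u + i) + suc n) * (2 * suc (u + i) + suc n) ≤ 5 * (suc n * suc n)
  above {i} _ = <⇒≱ (<-≤-trans 1+n<φ[1+u] (2*+-squared-monoˡ-≤ (suc n) (s<s (m≤m+n u i))))

G∘FibSum≡FibSumFrom0 : ∀ β → G (FibSum β) ≡ FibSumFrom 0 β
G∘FibSum≡FibSumFrom0 β = ≡⌊/φ⌋⇒G≡ (FibSumFrom0≡⌊1+FibSum/φ⌋ β)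

theorem1 : {c ℓ : Level} (H : Group c ℓ) (a : Group.Carrier H) (v : ℕ) (β : List Bool) →
    FibSum β ≡ v →
    (Group._≈_ H (proj₁ (de H a β)) (pow H a (G v))) × (Group._≈_ H (proj₂ (de H a β)) (pow H a v))
theorem1 H a v β refl with d≈aᵘ , e≈aᵛ ← de≈pow H a β =
  Group.trans H d≈aᵘ (Group.reflexive H (cong (pow H a) (≡.sym (G∘FibSum≡FibSumFrom0 β)))) , e≈aᵛ
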